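{- Let $d_{n,k}$ be the number of dispersed Dyck paths of length $n$ having exactly $k$ 1-descents, and let $\Phi(z,t)=\sum_{n,k}d_{n,k}z^nt^k$. Then \[ \Phi(z,t)=\frac{1-r_2}{1-2z+z^2-z^3-z^2t+z^3t},\qquad r_2=\frac{1+z^2-z^2t-W}{2z}, \] where $W=\sqrt{1-2z^2t-2z^2+z^4t^2+2z^4t-3z^4}$. Moreover the generating function of the total number of 1-descents in dispersed Dyck paths of length $n$ is \[ \frac{\partial \Phi}{\partial t}\Big|_{t=1}=\frac{z^2\bigl(1-4z^2+\sqrt{1-4z^2}\bigr)}{2(1-2z)(1-4z^2)}. \]
   Context: A dispersed Dyck path of length $n$ is a sequence of $n$ steps, each an up-step $U=(1,1)$, a down-step $D=(1,-1)$, or a flat step $H=(1,0)$, starting at $(0,0)$, ending on the $x$-axis, never going below the $x$-axis, such that flat steps occur only on the $x$-axis. A descent is a maximal run of consecutive $D$ steps; a 1-descent is a descent consisting of exactly one $D$ step. -}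

module Defs where

open import Data.Nat as ℕ using (ℕ; zero; suc; _≡ᵇ_)
open import Data.Bool using (Bool; true; false; if_then_else_)
open import Data.List using (List; []; _∷_; map; concatMap; filter; length)
open import Data.Nat.ListAction using (sum)
open import Data.Integer using (+_)
open import Data.Rational as Q using (ℚ; 0ℚ; 1ℚ)
open import Relation.Binary.PropositionalEquality using (_≡_)

data Step : Set where
  U D H : Step

words : ℕ → List (List Step)
words zero = [] ∷ []
words (suc n) = concatMap (λ w → (U ∷ w) ∷ (D ∷ w) ∷ (H ∷ w) ∷ []) (words n)

-- validFrom h w : starting at height h, w stays ≥ 0, flat steps only at
-- height 0, and ends at height 0.
validFrom : ℕ → List Step → Bool
validFrom zero [] = true
validFrom (suc h) [] = false
validFrom h (U ∷ s) = validFrom (suc h) s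
validFrom zero (D ∷ s) = false
validFrom (suc h) (D ∷ s) = validFrom h s
validFrom zero (H ∷ s) = validFrom zero s
validFrom (suc h) (H ∷ s) = false

isDispersedDyck : List Step → Bool
isDispersedDyck = validFrom zero

paths : ℕ → List (List Step)
paths n = filter (λ w → Data.Bool.T? (isDispersedDyck w)) (words n)
  where import Data.Bool

-- number of 1-descents (maximal runs of D of length exactly 1)
mutual
  oneDesc : List Step → ℕ
  oneDesc [] = 0
  oneDesc (D ∷ s) = afterFirstD s
  oneDesc (U ∷ s) = oneDesc s
  oneDesc (H ∷ s) = oneDesc s

  -- just read the first D of a descent
  afterFirstD : List Step → ℕ
  afterFirstD [] = 1
  afterFirstD (D ∷ s) = inLongRun s
  afterFirstD (U ∷ s) = suc (oneDesc s)
  afterFirstD (H ∷ s) = suc (oneDesc s)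

  -- inside a descent of length ≥ 2
  inLongRun : List Step → ℕ
  inLongRun [] = 0
  inLongRun (D ∷ s) = inLongRun s
  inLongRun (U ∷ s) = oneDesc s
  inLongRun (H ∷ s) = oneDesc s

d : ℕ → ℕ → ℕ
d n k = length (filter (λ w → Data.Bool.T? (oneDesc w ≡ᵇ k)) (paths n))
  where import Data.Bool

totalOneDesc : ℕ → ℕ
totalOneDesc n = sum (map oneDesc (paths n))

fromℕ : ℕ → ℚ
fromℕ n = + n Q./ 1

Σ≤ : ℕ → (ℕ → ℚ) → ℚ
Σ≤ zero f = f 0
Σ≤ (suc n) f = Σ≤ n f Q.+ f (suc n)

Ser1 : Set
Ser1 = ℕ → ℚ

-- bivariate series in z, t: coefficient of z^n t^k
Ser2 : Set
Ser2 = ℕ → ℕ → ℚ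

module S1 where
  const : ℚ → Ser1
  const c zero = c
  const c (suc n) = 0ℚ

  z : Ser1
  z 1 = 1ℚ
  z _ = 0ℚ

  infixl 6 _+_ _-_
  infixl 7 _*_
  _+_ _-_ _*_ : Ser1 → Ser1 → Ser1
  (f + g) n = f n Q.+ g n
  (f - g) n = f n Q.- g n
  (f * g) n = Σ≤ n (λ i → f i Q.* g (n ℕ.∸ i))

  infix 4 _≈_
  _≈_ : Ser1 → Ser1 → Set
  f ≈ g = ∀ n → f n ≡ g n

module S2 where
  const : ℚ → Ser2
  const c zero zero = c
  const c _ _ = 0ℚ

  z : Ser2
  z 1 0 = 1ℚ
  z _ _ = 0ℚ

  t : Ser2
  t 0 1 = 1ℚ
  t _ _ = 0ℚ

  infixl 6 _+_ _-_
  infixl 7 _*_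
  _+_ _-_ _*_ : Ser2 → Ser2 → Ser2
  (f + g) n k = f n k Q.+ g n k
  (f - g) n k = f n k Q.- g n k
  (f * g) n k = Σ≤ n (λ i → Σ≤ k (λ j → f i j Q.* g (n ℕ.∸ i) (k ℕ.∸ j)))

  infix 4 _≈_
  _≈_ : Ser2 → Ser2 → Set
  f ≈ g = ∀ n k → f n k ≡ g n k

Φ : Ser2
Φ n k = fromℕ (d n k)

Ψ : Ser1
Ψ n = fromℕ (totalOneDesc n)



one₂ two₂ : Ser2
one₂ = S2.const 1ℚ
two₂ = S2.const (fromℕ 2)

radicand : Ser2
radicand = let open S2 ; z² = z * z ; z⁴ = z² * z² in
  one₂ - two₂ * z² * t - two₂ * z² + z⁴ * t * t + two₂ * z⁴ * t
       - const (fromℕ 3) * z⁴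

aPoly : Ser2
aPoly = let open S2 in one₂ + z * z - z * z * t

denomPoly : Ser2
denomPoly = let open S2 ; z² = z * z ; z³ = z² * z in
  one₂ - two₂ * z + z² - z³ - z² * t + z³ * t

one₁ : Ser1
one₁ = S1.const 1ℚ

oneMinus4z² : Ser1
oneMinus4z² = let open S1 in one₁ - const (fromℕ 4) * z * z

denom₁ : Ser1
denom₁ = let open S1 in const (fromℕ 2) * (one₁ - const (fromℕ 2) * z) * oneMinus4z²

module Submission where

-- A nonempty dispersed path is H followed by a dispersed path, or U A D B where A is a Dyck path
-- and B a dispersed path (first return to the axis).  The D after A lengthens the last descent of A,
-- so the 1-descents of U A D B are those of B together with the closed 1-descents of A (those
-- followed by a further step), plus one when A is empty.  Marking closed 1-descents of Dyck paths
-- by t, the same decomposition gives Q = 1 + z²(1 + t(Q - 1) + (Q - 1)Q) and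
-- Φ = 1 + zΦ + z²(t + Q - 1)Φ.  By the equation for Q, 1 + z² - z²t - 2z²Q squares to the
-- radicand; its constant term is 1 like that of W, and 2 is invertible, so it is W.  Hence
-- r₂ = zQ, and Φ (1 - 2z + z² - z³ - z²t + z³t) = 1 - zQ is ring arithmetic.  Counting 1-descents
-- instead of marking them gives linear equations for the totals over Dyck and dispersed paths,
-- which together with S = 1 - 2z²C (C counting Dyck paths) yield the second identity.

open import Defs
open import Algebra.Bundles using (CommutativeRing; Semiring; RawRing)
open import Algebra.Solver.Ring.AlmostCommutativeRing
  using ( AlmostCommutativeRing; _-Raw-AlmostCommutative⟶_; -raw-almostCommutative⟶
        ; fromCommutativeRing; Induced-equivalence)
open import Data.Bool using (Bool; true; false)
open import Data.List using (List; []; _∷_; _++_; concat; map; filter; length)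
open import Data.Maybe using (just; nothing)
open import Data.Nat as ℕ using (ℕ; zero; suc)
import Data.Nat.Properties as ℕP
open import Data.Product using (_×_; _,_)
open import Function using (_∘_)
open import Level using (_⊔_)
open import Relation.Binary using (Rel; WeaklyDecidable)
open import Relation.Binary.PropositionalEquality as ≡ using (_≡_)
open import Data.Rational as ℚ using (ℚ; 0ℚ; 1ℚ)
import Data.Rational.Properties as ℚP
open import Relation.Binary.Consequences using (dec⇒weaklyDec)
import Algebra.Solver.Ring as RingSolver

-- 1-descents across a first return

dyckFrom : ℕ → List Step → Bool
dyckFrom h       (U ∷ s) = dyckFrom (suc h) s
dyckFrom zero    (D ∷ s) = false
dyckFrom (suc h) (D ∷ s) = dyckFrom h s
dyckFrom _       (H ∷ s) = false
dyckFrom zero    []      = true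
dyckFrom (suc _) []      = false

data Phase : Set where
  outside single long : Phase

-- oneDesc, afterFirstD and inLongRun are the runs of one transducer from these three phases.
run : Phase → List Step → ℕ
run outside = oneDesc
run single  = afterFirstD
run long    = inLongRun

next : Phase → Step → Phase
next _       U = outside
next _       H = outside
next outside D = single
next single  D = long
next long    D = long

closes : Phase → Step → ℕ
closes single U = 1
closes single H = 1
closes _      _ = 0

closed : Phase → List Step → ℕ
closed s []      = 0
closed s (x ∷ w) = closes s x ℕ.+ closed (next s x) w

final : Phase → List Step → Phase
final s []      = s
final s (x ∷ w) = final (next s x) w

closedOneDesc : List Step → ℕ
closedOneDesc = closed outside

startsWithD : List Step → Bool
startsWithD (D ∷ _) = true
startsWithD _       = false

run-∷ : ∀ s x w → run s (x ∷ w) ≡ closes s x ℕ.+ run (next s x) w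
run-∷ outside U w = ≡.refl
run-∷ outside D w = ≡.refl
run-∷ outside H w = ≡.refl
run-∷ single  U w = ≡.refl
run-∷ single  D w = ≡.refl
run-∷ single  H w = ≡.refl
run-∷ long    U w = ≡.refl
run-∷ long    D w = ≡.refl
run-∷ long    H w = ≡.refl

run-++ : ∀ s u v → run s (u ++ v) ≡ closed s u ℕ.+ run (final s u) v
run-++ s []      v = ≡.refl
run-++ s (x ∷ u) v = ≡.trans (run-∷ s x (u ++ v))
  (≡.trans (≡.cong (closes s x ℕ.+_) (run-++ (next s x) u v)) (≡.sym (ℕP.+-assoc (closes s x) _ _)))

closed-++ : ∀ s u v → closed s (u ++ v) ≡ closed s u ℕ.+ closed (final s u) v
closed-++ s []      v = ≡.refl
closed-++ s (x ∷ u) v = ≡.trans (≡.cong (closes s x ℕ.+_) (closed-++ (next s x) u v))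
  (≡.sym (ℕP.+-assoc (closes s x) _ _))

-- A nonempty Dyck path ends with a D, so a following D lengthens its last descent.
final-dyck : ∀ g s x u → dyckFrom g (x ∷ u) ≡ true → next (final s (x ∷ u)) D ≡ long
final-dyck g       s U []      ()
final-dyck zero    s D []      ()
final-dyck (suc g) outside D [] _ = ≡.refl
final-dyck (suc g) single  D [] _ = ≡.refl
final-dyck (suc g) long    D [] _ = ≡.refl
final-dyck g       s H []      ()
final-dyck g       s U (y ∷ u) dyck = final-dyck (suc g) outside y u dyck
final-dyck zero    s D (y ∷ u) ()
final-dyck (suc g) s D (y ∷ u) dyck = final-dyck g (next s D) y u dyck
final-dyck g       s H (y ∷ u) ()

closes-D : ∀ s → closes s D ≡ 0
closes-D outside = ≡.refl
closes-D single  = ≡.refl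
closes-D long    = ≡.refl

run-single : ∀ B → startsWithD B ≡ false → run single B ≡ 1 ℕ.+ oneDesc B
run-single []      _ = ≡.refl
run-single (U ∷ B) _ = ≡.refl
run-single (H ∷ B) _ = ≡.refl

run-long : ∀ B → startsWithD B ≡ false → run long B ≡ oneDesc B
run-long []      _ = ≡.refl
run-long (U ∷ B) _ = ≡.refl
run-long (H ∷ B) _ = ≡.refl

closed-single : ∀ x w → startsWithD (x ∷ w) ≡ false → closed single (x ∷ w) ≡ suc (closedOneDesc (x ∷ w))
closed-single U w _ = ≡.refl
closed-single H w _ = ≡.refl

closed-long : ∀ B → startsWithD B ≡ false → closed long B ≡ closedOneDesc B
closed-long []      _ = ≡.refl
closed-long (U ∷ B) _ = ≡.refl
closed-long (H ∷ B) _ = ≡.refl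

dispersed-head : ∀ B → validFrom 0 B ≡ true → startsWithD B ≡ false
dispersed-head []      _ = ≡.refl
dispersed-head (U ∷ B) _ = ≡.refl
dispersed-head (H ∷ B) _ = ≡.refl

dyck-head : ∀ B → dyckFrom 0 B ≡ true → startsWithD B ≡ false
dyck-head []      _ = ≡.refl
dyck-head (U ∷ B) _ = ≡.refl

oneDesc-return : ∀ x A B → dyckFrom 0 (x ∷ A) ≡ true → startsWithD B ≡ false →
  oneDesc (x ∷ A ++ D ∷ B) ≡ closedOneDesc (x ∷ A) ℕ.+ oneDesc B
oneDesc-return x A B dyck B≠D = begin
  oneDesc ((x ∷ A) ++ D ∷ B)
    ≡⟨ run-++ outside (x ∷ A) (D ∷ B) ⟩
  closedOneDesc (x ∷ A) ℕ.+ run s (D ∷ B)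
    ≡⟨ ≡.cong (closedOneDesc (x ∷ A) ℕ.+_) (run-∷ s D B) ⟩
  closedOneDesc (x ∷ A) ℕ.+ (closes s D ℕ.+ run (next s D) B)
    ≡⟨ ≡.cong₂ (λ k p → closedOneDesc (x ∷ A) ℕ.+ (k ℕ.+ run p B)) (closes-D s) (final-dyck 0 outside x A dyck) ⟩
  closedOneDesc (x ∷ A) ℕ.+ run long B
    ≡⟨ ≡.cong (closedOneDesc (x ∷ A) ℕ.+_) (run-long B B≠D) ⟩
  closedOneDesc (x ∷ A) ℕ.+ oneDesc B ∎
  where
  open ≡.≡-Reasoning
  s : Phase
  s = final outside (x ∷ A)

closedOneDesc-return : ∀ x A B → dyckFrom 0 (x ∷ A) ≡ true → startsWithD B ≡ false →
  closedOneDesc (x ∷ A ++ D ∷ B) ≡ closedOneDesc (x ∷ A) ℕ.+ closedOneDesc B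
closedOneDesc-return x A B dyck B≠D = begin
  closedOneDesc ((x ∷ A) ++ D ∷ B)
    ≡⟨ closed-++ outside (x ∷ A) (D ∷ B) ⟩
  closedOneDesc (x ∷ A) ℕ.+ (closes s D ℕ.+ closed (next s D) B)
    ≡⟨ ≡.cong₂ (λ k p → closedOneDesc (x ∷ A) ℕ.+ (k ℕ.+ closed p B)) (closes-D s) (final-dyck 0 outside x A dyck) ⟩
  closedOneDesc (x ∷ A) ℕ.+ closed long B
    ≡⟨ ≡.cong (closedOneDesc (x ∷ A) ℕ.+_) (closed-long B B≠D) ⟩
  closedOneDesc (x ∷ A) ℕ.+ closedOneDesc B ∎
  where
  open ≡.≡-Reasoning
  s : Phase
  s = final outside (x ∷ A)

-- Regular elements and formal power series

module CommutativeRingLemmas {c ℓ} (R : CommutativeRing c ℓ) where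

  open CommutativeRing R
  open import Algebra.Properties.Ring ring using ([y-z]x≈yx-zx)
  open import Algebra.Properties.Group +-group using (x∙y⁻¹≈ε⇒x≈y; x≈y⇒x∙y⁻¹≈ε)
  open import Relation.Binary.Reasoning.Setoid setoid

  Regular : Carrier → Set (c ⊔ ℓ)
  Regular a = ∀ x → x * a ≈ 0# → x ≈ 0#

  regular-* : ∀ {a b} → Regular a → Regular b → Regular (a * b)
  regular-* {a} {b} reg-a reg-b x xab≈0 =
    reg-a x (reg-b (x * a) (trans (*-assoc x a b) xab≈0))

  regular-cancelʳ : ∀ {a} → Regular a → ∀ {x y} → x * a ≈ y * a → x ≈ y
  regular-cancelʳ {a} reg {x} {y} xa≈ya = x∙y⁻¹≈ε⇒x≈y x y (reg (x - y) (begin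
    (x - y) * a      ≈⟨ [y-z]x≈yx-zx a x y ⟩
    x * a - y * a    ≈⟨ x≈y⇒x∙y⁻¹≈ε xa≈ya ⟩
    0#               ∎))

  modulo : ∀ {a b} y c → a ≈ b → y + c * (a - b) ≈ y
  modulo y c a≈b = trans (+-congˡ (trans (*-congˡ (x≈y⇒x∙y⁻¹≈ε a≈b)) (zeroʳ c))) (+-identityʳ y)

  square-root-unique : ∀ {x y} → Regular (x + y) → x * x ≈ y * y → x ≈ y
  square-root-unique {x} {y} reg xx≈yy = regular-cancelʳ reg (begin
    x * (x + y)      ≈⟨ distribˡ x x y ⟩
    x * x + x * y    ≈⟨ +-congʳ xx≈yy ⟩
    y * y + x * y    ≈⟨ +-comm (y * y) (x * y) ⟩
    x * y + y * y    ≈⟨ +-congʳ (*-comm x y) ⟩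
    y * x + y * y    ≈⟨ distribˡ y x y ⟨
    y * (x + y)      ∎)

module PowerSeries {c ℓ} (R : CommutativeRing c ℓ) where

  open CommutativeRing R
  open import Algebra.Properties.CommutativeSemigroup +-commutativeSemigroup
    using () renaming (interchange to +-interchange)
  open import Algebra.Structures using (IsCommutativeRing)
  import Algebra.Construct.Pointwise as Pointwise
  open import Relation.Binary.Reasoning.Setoid setoid
  open CommutativeRingLemmas R using (Regular)

  Series : Set c
  Series = ℕ → Carrier

  infix 4 _≋_
  _≋_ : Rel Series ℓ
  f ≋ g = ∀ n → f n ≈ g n

  infixl 6 _⊕_
  infixl 7 _⊛_

  _⊕_ : Series → Series → Series
  (f ⊕ g) n = f n + g n

  ⊖_ : Series → Series
  (⊖ f) n = - f n

  𝟘 : Series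
  𝟘 _ = 0#

  const : Carrier → Series
  const a zero    = a
  const a (suc _) = 0#

  𝟙 : Series
  𝟙 = const 1#

  X : Series
  X zero          = 0#
  X (suc zero)    = 1#
  X (suc (suc _)) = 0#

  -- (f ⊛ g) n = Σ_{i ≤ n} f i * g (n ∸ i), unfolded along f so that proofs go by induction on n.
  _⊛_ : Series → Series → Series
  (f ⊛ g) zero    = f 0 * g 0
  (f ⊛ g) (suc n) = f 0 * g (suc n) + ((f ∘ suc) ⊛ g) n

  ⊛-cong : ∀ {f f′ g g′} → f ≋ f′ → g ≋ g′ → f ⊛ g ≋ f′ ⊛ g′
  ⊛-cong f≋f′ g≋g′ zero    = *-cong (f≋f′ 0) (g≋g′ 0)
  ⊛-cong f≋f′ g≋g′ (suc n) =
    +-cong (*-cong (f≋f′ 0) (g≋g′ (suc n))) (⊛-cong (f≋f′ ∘ suc) g≋g′ n)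

  ⊛-zeroˡ : ∀ {f} g → f ≋ 𝟘 → f ⊛ g ≋ 𝟘
  ⊛-zeroˡ g f≋0 zero    = trans (*-congʳ (f≋0 0)) (zeroˡ (g 0))
  ⊛-zeroˡ g f≋0 (suc n) =
    trans (+-cong (trans (*-congʳ (f≋0 0)) (zeroˡ _)) (⊛-zeroˡ g (f≋0 ∘ suc) n)) (+-identityˡ 0#)

  ⊛-distribʳ : ∀ f g h → (f ⊕ g) ⊛ h ≋ f ⊛ h ⊕ g ⊛ h
  ⊛-distribʳ f g h zero    = distribʳ (h 0) (f 0) (g 0)
  ⊛-distribʳ f g h (suc n) =
    trans (+-cong (distribʳ _ (f 0) (g 0)) (⊛-distribʳ (f ∘ suc) (g ∘ suc) h n)) (+-interchange _ _ _ _)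

  ⊛-distribˡ : ∀ f g h → f ⊛ (g ⊕ h) ≋ f ⊛ g ⊕ f ⊛ h
  ⊛-distribˡ f g h zero    = distribˡ (f 0) (g 0) (h 0)
  ⊛-distribˡ f g h (suc n) =
    trans (+-cong (distribˡ (f 0) _ _) (⊛-distribˡ (f ∘ suc) g h n)) (+-interchange _ _ _ _)

  *-⊛ : ∀ a f g n → ((λ i → a * f i) ⊛ g) n ≈ a * (f ⊛ g) n
  *-⊛ a f g zero    = *-assoc a (f 0) (g 0)
  *-⊛ a f g (suc n) =
    trans (+-cong (*-assoc a (f 0) _) (*-⊛ a (f ∘ suc) g n)) (sym (distribˡ a _ _))

  ⊛-unfoldʳ : ∀ f g n → (f ⊛ g) (suc n) ≈ (f ⊛ (g ∘ suc)) n + f (suc n) * g 0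
  ⊛-unfoldʳ f g zero    = refl
  ⊛-unfoldʳ f g (suc n) = begin
    f 0 * g (suc (suc n)) + ((f ∘ suc) ⊛ g) (suc n)
      ≈⟨ +-congˡ (⊛-unfoldʳ (f ∘ suc) g n) ⟩
    f 0 * g (suc (suc n)) + (((f ∘ suc) ⊛ (g ∘ suc)) n + f (suc (suc n)) * g 0)
      ≈⟨ +-assoc _ _ _ ⟨
    (f ⊛ (g ∘ suc)) (suc n) + f (suc (suc n)) * g 0 ∎

  ⊛-comm : ∀ f g → f ⊛ g ≋ g ⊛ f
  ⊛-comm f g zero          = *-comm (f 0) (g 0)
  ⊛-comm f g (suc zero)    = trans (+-cong (*-comm (f 0) (g 1)) (*-comm (f 1) (g 0))) (+-comm _ _)
  ⊛-comm f g (suc (suc n)) = begin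
    (f ⊛ g) (2 ℕ.+ n)
      ≈⟨ unfold₂ f g ⟩
    (f 0 * g (2 ℕ.+ n) + ((f ∘ suc) ⊛ (g ∘ suc)) n) + f (2 ℕ.+ n) * g 0
      ≈⟨ +-cong (+-congˡ (⊛-comm (f ∘ suc) (g ∘ suc) n)) (*-comm _ _) ⟩
    (f 0 * g (2 ℕ.+ n) + ((g ∘ suc) ⊛ (f ∘ suc)) n) + g 0 * f (2 ℕ.+ n)
      ≈⟨ +-assoc _ _ _ ⟩
    f 0 * g (2 ℕ.+ n) + (((g ∘ suc) ⊛ (f ∘ suc)) n + g 0 * f (2 ℕ.+ n))
      ≈⟨ +-comm _ _ ⟩
    (((g ∘ suc) ⊛ (f ∘ suc)) n + g 0 * f (2 ℕ.+ n)) + f 0 * g (2 ℕ.+ n)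
      ≈⟨ +-cong (+-comm _ _) (*-comm _ _) ⟩
    (g 0 * f (2 ℕ.+ n) + ((g ∘ suc) ⊛ (f ∘ suc)) n) + g (2 ℕ.+ n) * f 0
      ≈⟨ unfold₂ g f ⟨
    (g ⊛ f) (2 ℕ.+ n) ∎
    where
    unfold₂ : ∀ f g → (f ⊛ g) (2 ℕ.+ n) ≈ (f 0 * g (2 ℕ.+ n) + ((f ∘ suc) ⊛ (g ∘ suc)) n) + f (2 ℕ.+ n) * g 0
    unfold₂ f g = trans (+-congˡ (⊛-unfoldʳ (f ∘ suc) g n)) (sym (+-assoc _ _ _))

  ⊛-identityˡ : ∀ f → 𝟙 ⊛ f ≋ f
  ⊛-identityˡ f zero    = *-identityˡ (f 0)
  ⊛-identityˡ f (suc n) =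
    trans (+-cong (*-identityˡ _) (⊛-zeroˡ f (λ _ → refl) n)) (+-identityʳ _)

  const-⊛ : ∀ a f n → (const a ⊛ f) n ≈ a * f n
  const-⊛ a f zero    = refl
  const-⊛ a f (suc n) = trans (+-congˡ (⊛-zeroˡ f (λ _ → refl) n)) (+-identityʳ _)

  X-⊛-zero : ∀ f → (X ⊛ f) 0 ≈ 0#
  X-⊛-zero f = zeroˡ (f 0)

  X-⊛-suc : ∀ f n → (X ⊛ f) (suc n) ≈ f n
  X-⊛-suc f n = trans (+-cong (zeroˡ _) (trans (⊛-cong X∘suc≋𝟙 (λ _ → refl) n) (⊛-identityˡ f n)))
                      (+-identityˡ _)
    where
    X∘suc≋𝟙 : X ∘ suc ≋ 𝟙
    X∘suc≋𝟙 zero    = refl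
    X∘suc≋𝟙 (suc _) = refl

  ⊛-assoc : ∀ f g h → (f ⊛ g) ⊛ h ≋ f ⊛ (g ⊛ h)
  ⊛-assoc f g h zero    = *-assoc (f 0) (g 0) (h 0)
  ⊛-assoc f g h (suc n) = begin
    (f 0 * g 0) * h (suc n) + (((f ⊛ g) ∘ suc) ⊛ h) n
      ≈⟨ +-congˡ (⊛-distribʳ (λ i → f 0 * g (suc i)) ((f ∘ suc) ⊛ g) h n) ⟩
    (f 0 * g 0) * h (suc n) + (((λ i → f 0 * g (suc i)) ⊛ h) n + (((f ∘ suc) ⊛ g) ⊛ h) n)
      ≈⟨ +-congˡ (+-cong (*-⊛ (f 0) (g ∘ suc) h n) (⊛-assoc (f ∘ suc) g h n)) ⟩
    (f 0 * g 0) * h (suc n) + (f 0 * ((g ∘ suc) ⊛ h) n + ((f ∘ suc) ⊛ (g ⊛ h)) n)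
      ≈⟨ +-assoc _ _ _ ⟨
    ((f 0 * g 0) * h (suc n) + f 0 * ((g ∘ suc) ⊛ h) n) + ((f ∘ suc) ⊛ (g ⊛ h)) n
      ≈⟨ +-congʳ (trans (+-congʳ (*-assoc _ _ _)) (sym (distribˡ (f 0) _ _))) ⟩
    f 0 * (g ⊛ h) (suc n) + ((f ∘ suc) ⊛ (g ⊛ h)) n ∎

  series-isCommutativeRing : IsCommutativeRing _≋_ _⊕_ _⊛_ ⊖_ 𝟘 𝟙
  series-isCommutativeRing = record
    { isRing = record
      { +-isAbelianGroup = Pointwise.isAbelianGroup ℕ +-isAbelianGroup
      ; *-cong           = ⊛-cong
      ; *-assoc          = ⊛-assoc
      ; *-identity       = ⊛-identityˡ , λ f n → trans (⊛-comm f 𝟙 n) (⊛-identityˡ f n)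
      ; distrib          = ⊛-distribˡ , λ h f g → ⊛-distribʳ f g h
      }
    ; *-comm = ⊛-comm
    }

  seriesRing : CommutativeRing c ℓ
  seriesRing = record { isCommutativeRing = series-isCommutativeRing }

  const-cong : ∀ {a b} → a ≈ b → const a ≋ const b
  const-cong a≈b zero    = a≈b
  const-cong a≈b (suc _) = refl

  const-+ : ∀ a b → const (a + b) ≋ const a ⊕ const b
  const-+ a b zero    = refl
  const-+ a b (suc _) = sym (+-identityˡ 0#)

  const-* : ∀ a b → const (a * b) ≋ const a ⊛ const b
  const-* a b n = sym (trans (const-⊛ a (const b) n) (lemma n))
    where
    lemma : ∀ n → a * const b n ≈ const (a * b) n
    lemma zero    = refl
    lemma (suc _) = zeroʳ a

  const-neg : ∀ a → const (- a) ≋ ⊖ const a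
  const-neg a zero    = refl
  const-neg a (suc _) = sym (-0#≈0#)
    where open import Algebra.Properties.Ring ring using (-0#≈0#)

  const-0 : const 0# ≋ 𝟘
  const-0 zero    = refl
  const-0 (suc _) = refl

  liftMorphism : ∀ {r₁ r₂} {C : RawRing r₁ r₂} →
    C -Raw-AlmostCommutative⟶ fromCommutativeRing R →
    C -Raw-AlmostCommutative⟶ fromCommutativeRing seriesRing
  liftMorphism {C = C} φ = record
    { ⟦_⟧    = λ p → const ⟦ p ⟧
    ; +-homo = λ p q → ≋-trans (const-cong (+-homo p q)) (const-+ ⟦ p ⟧ ⟦ q ⟧)
    ; *-homo = λ p q → ≋-trans (const-cong (*-homo p q)) (const-* ⟦ p ⟧ ⟦ q ⟧)
    ; -‿homo = λ p → ≋-trans (const-cong (-‿homo p)) (const-neg ⟦ p ⟧)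
    ; 0-homo = ≋-trans (const-cong 0-homo) const-0
    ; 1-homo = const-cong 1-homo
    }
    where
    open _-Raw-AlmostCommutative⟶_ φ
    ≋-trans : ∀ {f g h} → f ≋ g → g ≋ h → f ≋ h
    ≋-trans f≋g g≋h n = trans (f≋g n) (g≋h n)

  liftCoeff≟ : ∀ {r₁ r₂} {C : RawRing r₁ r₂} (φ : C -Raw-AlmostCommutative⟶ fromCommutativeRing R) →
    WeaklyDecidable (Induced-equivalence φ) → WeaklyDecidable (Induced-equivalence (liftMorphism φ))
  liftCoeff≟ φ _≟_ p q with p ≟ q
  ... | just eq = just (const-cong eq)
  ... | nothing = nothing

  regular-by-constant-term : ∀ {g} → Regular (g 0) → ∀ f → f ⊛ g ≋ 𝟘 → f ≋ 𝟘
  regular-by-constant-term reg f fg≋0 zero    = reg (f 0) (fg≋0 0)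
  regular-by-constant-term {g} reg f fg≋0 (suc n) = regular-by-constant-term reg (f ∘ suc) shift≋0 n
    where
    f0≈0 : f 0 ≈ 0#
    f0≈0 = reg (f 0) (fg≋0 0)
    shift≋0 : (f ∘ suc) ⊛ g ≋ 𝟘
    shift≋0 m = begin
      ((f ∘ suc) ⊛ g) m                 ≈⟨ +-identityˡ _ ⟨
      0# + ((f ∘ suc) ⊛ g) m            ≈⟨ +-congʳ (trans (*-congʳ f0≈0) (zeroˡ _)) ⟨
      f 0 * g (suc m) + ((f ∘ suc) ⊛ g) m ≈⟨ fg≋0 (suc m) ⟩
      0#                                ∎

  X-regular : ∀ f → f ⊛ X ≋ 𝟘 → f ≋ 𝟘
  X-regular f fX≋0 n = trans (sym (X-⊛-suc f n)) (trans (⊛-comm X f (suc n)) (fX≋0 (suc n)))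

  series-by-shift : ∀ {f g a} → f 0 ≈ a → (∀ n → f (suc n) ≈ g n) → f ≋ const a ⊕ X ⊛ g
  series-by-shift {g = g} f0≈a _ zero = trans f0≈a (sym (trans (+-congˡ (X-⊛-zero g)) (+-identityʳ _)))
  series-by-shift {g = g} _ shift (suc n) = trans (shift n) (sym (trans (+-identityˡ _) (X-⊛-suc g n)))

-- Sums over words

module WordSums {c ℓ} (S : Semiring c ℓ) where

  open Semiring S hiding (zero)
  open import Algebra.Properties.CommutativeSemigroup +-commutativeSemigroup
    using () renaming (interchange to +-interchange)
  open import Relation.Binary.Reasoning.Setoid setoid

  when : Bool → Carrier → Carrier
  when true  x = x
  when false _ = 0#

  when-cong : ∀ b {x y} → (b ≡ true → x ≈ y) → when b x ≈ when b y
  when-cong true  x≈y = x≈y ≡.refl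
  when-cong false _   = refl

  when-+ : ∀ b x y → when b (x + y) ≈ when b x + when b y
  when-+ true  x y = refl
  when-+ false x y = sym (+-identityˡ 0#)

  when-*ˡ : ∀ b x y → when b (x * y) ≈ x * when b y
  when-*ˡ true  x y = refl
  when-*ˡ false x y = sym (zeroʳ x)

  when-*ʳ : ∀ b x y → when b (x * y) ≈ when b x * y
  when-*ʳ true  x y = refl
  when-*ʳ false x y = sym (zeroˡ y)

  module _ {a} {A : Set a} where

    Σ-list : List A → (A → Carrier) → Carrier
    Σ-list []       f = 0#
    Σ-list (x ∷ xs) f = f x + Σ-list xs f

    Σ-list-cong : ∀ xs {f g} → (∀ x → f x ≈ g x) → Σ-list xs f ≈ Σ-list xs g
    Σ-list-cong []       f≈g = refl
    Σ-list-cong (x ∷ xs) f≈g = +-cong (f≈g x) (Σ-list-cong xs f≈g)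

    Σ-list-+ : ∀ xs f g → Σ-list xs (λ x → f x + g x) ≈ Σ-list xs f + Σ-list xs g
    Σ-list-+ []       f g = sym (+-identityˡ 0#)
    Σ-list-+ (x ∷ xs) f g = trans (+-congˡ (Σ-list-+ xs f g)) (+-interchange _ _ _ _)

    Σ-list-*ˡ : ∀ xs a f → Σ-list xs (λ x → a * f x) ≈ a * Σ-list xs f
    Σ-list-*ˡ []       a f = sym (zeroʳ a)
    Σ-list-*ˡ (x ∷ xs) a f = trans (+-congˡ (Σ-list-*ˡ xs a f)) (sym (distribˡ a _ _))

    Σ-list-*ʳ : ∀ xs a f → Σ-list xs (λ x → f x * a) ≈ Σ-list xs f * a
    Σ-list-*ʳ []       a f = sym (zeroˡ a)
    Σ-list-*ʳ (x ∷ xs) a f = trans (+-congˡ (Σ-list-*ʳ xs a f)) (sym (distribʳ a _ _))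

    Σ-list-0 : ∀ xs → Σ-list xs (λ _ → 0#) ≈ 0#
    Σ-list-0 []       = refl
    Σ-list-0 (x ∷ xs) = trans (+-identityˡ _) (Σ-list-0 xs)

    Σ-list-++ : ∀ xs ys f → Σ-list (xs ++ ys) f ≈ Σ-list xs f + Σ-list ys f
    Σ-list-++ []       ys f = sym (+-identityˡ _)
    Σ-list-++ (x ∷ xs) ys f = trans (+-congˡ (Σ-list-++ xs ys f)) (sym (+-assoc _ _ _))

  Σ-list-concat-map : ∀ {a b} {A : Set a} {B : Set b} (g : A → List B) xs f →
    Σ-list (concat (map g xs)) f ≈ Σ-list xs (λ x → Σ-list (g x) f)
  Σ-list-concat-map g []       f = refl
  Σ-list-concat-map g (x ∷ xs) f =
    trans (Σ-list-++ (g x) (concat (map g xs)) f) (+-congˡ (Σ-list-concat-map g xs f))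

  Σ-words : ℕ → (List Step → Carrier) → Carrier
  Σ-words n = Σ-list (words n)

  Σ-words-suc : ∀ n f →
    Σ-words (suc n) f ≈ Σ-words n (f ∘ (U ∷_)) + (Σ-words n (f ∘ (D ∷_)) + Σ-words n (f ∘ (H ∷_)))
  Σ-words-suc n f = begin
    Σ-words (suc n) f
      ≈⟨ Σ-list-concat-map _ (words n) f ⟩
    Σ-words n (λ w → f (U ∷ w) + (f (D ∷ w) + (f (H ∷ w) + 0#)))
      ≈⟨ Σ-list-cong (words n) (λ w → +-congˡ (+-congˡ (+-identityʳ _))) ⟩
    Σ-words n (λ w → f (U ∷ w) + (f (D ∷ w) + f (H ∷ w)))
      ≈⟨ Σ-list-+ (words n) _ _ ⟩
    Σ-words n (f ∘ (U ∷_)) + Σ-words n (λ w → f (D ∷ w) + f (H ∷ w))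
      ≈⟨ +-congˡ (Σ-list-+ (words n) _ _) ⟩
    Σ-words n (f ∘ (U ∷_)) + (Σ-words n (f ∘ (D ∷_)) + Σ-words n (f ∘ (H ∷_))) ∎

  Σ-words-suc-cong : ∀ n {f g} → (∀ x w → f (x ∷ w) ≈ g (x ∷ w)) → Σ-words (suc n) f ≈ Σ-words (suc n) g
  Σ-words-suc-cong n {f} {g} f≈g = begin
    Σ-words (suc n) f
      ≈⟨ Σ-list-concat-map _ (words n) f ⟩
    Σ-words n (λ w → f (U ∷ w) + (f (D ∷ w) + (f (H ∷ w) + 0#)))
      ≈⟨ Σ-list-cong (words n) (λ w → +-cong (f≈g U w) (+-cong (f≈g D w) (+-congʳ (f≈g H w)))) ⟩
    Σ-words n (λ w → g (U ∷ w) + (g (D ∷ w) + (g (H ∷ w) + 0#)))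
      ≈⟨ Σ-list-concat-map _ (words n) g ⟨
    Σ-words (suc n) g ∎

  Σ-words-product : ∀ m r (a b : List Step → Bool) (f g : List Step → Carrier) →
    Σ-words m (λ A → when (a A) (Σ-words r (λ B → when (b B) (f A * g B))))
      ≈ Σ-words m (λ A → when (a A) (f A)) * Σ-words r (λ B → when (b B) (g B))
  Σ-words-product m r a b f g = begin
    Σ-words m (λ A → when (a A) (Σ-words r (λ B → when (b B) (f A * g B))))
      ≈⟨ Σ-list-cong (words m) (λ A → when-cong (a A) (λ _ → inner A)) ⟩
    Σ-words m (λ A → when (a A) (f A * G))
      ≈⟨ Σ-list-cong (words m) (λ A → when-*ʳ (a A) (f A) G) ⟩
    Σ-words m (λ A → when (a A) (f A) * G)
      ≈⟨ Σ-list-*ʳ (words m) G _ ⟩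
    Σ-words m (λ A → when (a A) (f A)) * G ∎
    where
    G : Carrier
    G = Σ-words r (λ B → when (b B) (g B))
    inner : ∀ A → Σ-words r (λ B → when (b B) (f A * g B)) ≈ f A * G
    inner A = trans (Σ-list-cong (words r) (λ B → when-*ˡ (b B) (f A) (g B))) (Σ-list-*ˡ (words r) (f A) _)

  -- Σsplit n F sums F m r over m + 1 + r = n.
  Σsplit : ℕ → (ℕ → ℕ → Carrier) → Carrier
  Σsplit zero    F = 0#
  Σsplit (suc n) F = F 0 n + Σsplit n (λ m r → F (suc m) r)

  Σsplit-cong : ∀ n {F G} → (∀ m r → F m r ≈ G m r) → Σsplit n F ≈ Σsplit n G
  Σsplit-cong zero    F≈G = refl
  Σsplit-cong (suc n) F≈G = +-cong (F≈G 0 n) (Σsplit-cong n (λ m r → F≈G (suc m) r))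

  Σsplit-+ : ∀ n F G → Σsplit n (λ m r → F m r + G m r) ≈ Σsplit n F + Σsplit n G
  Σsplit-+ zero    F G = sym (+-identityˡ 0#)
  Σsplit-+ (suc n) F G = trans (+-congˡ (Σsplit-+ n _ _)) (+-interchange _ _ _ _)

  Σ-nested-suc-cong : ∀ m r (a b : List Step → Bool) {P Q : List Step → List Step → Carrier} →
    (∀ x A B → a (x ∷ A) ≡ true → b B ≡ true → P (x ∷ A) B ≈ Q (x ∷ A) B) →
    Σ-words (suc m) (λ A → when (a A) (Σ-words r (λ B → when (b B) (P A B))))
      ≈ Σ-words (suc m) (λ A → when (a A) (Σ-words r (λ B → when (b B) (Q A B))))
  Σ-nested-suc-cong m r a b P≈Q =
    Σ-words-suc-cong m (λ x A → when-cong (a (x ∷ A)) (λ aA →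
      Σ-list-cong (words r) (λ B → when-cong (b B) (P≈Q x A B aA))))

  Σ-nested-+ : ∀ m r (a b : List Step → Bool) (P Q : List Step → List Step → Carrier) →
    Σ-words m (λ A → when (a A) (Σ-words r (λ B → when (b B) (P A B + Q A B))))
      ≈ Σ-words m (λ A → when (a A) (Σ-words r (λ B → when (b B) (P A B))))
        + Σ-words m (λ A → when (a A) (Σ-words r (λ B → when (b B) (Q A B))))
  Σ-nested-+ m r a b P Q =
    trans (Σ-list-cong (words m) (λ A →
             trans (when-cong (a A) (λ _ →
                      trans (Σ-list-cong (words r) (λ B → when-+ (b B) (P A B) (Q A B))) (Σ-list-+ (words r) _ _)))
                   (when-+ (a A) _ _)))
          (Σ-list-+ (words m) _ _)

  -- A path from height 1 + g + h first reaches height h by a D step that follows a Dyck path from relative height g.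
  module FirstReturn (V : ℕ → List Step → Bool)
    (V-[] : ∀ h → V (suc h) [] ≡ false)
    (V-U : ∀ h w → V (suc h) (U ∷ w) ≡ V (suc (suc h)) w)
    (V-D : ∀ h w → V (suc h) (D ∷ w) ≡ V h w)
    (V-H : ∀ h w → V (suc h) (H ∷ w) ≡ false) where

    returns : ℕ → ℕ → (List Step → Carrier) → ℕ → ℕ → Carrier
    returns g h P m r =
      Σ-words m (λ A → when (dyckFrom g A) (Σ-words r (λ B → when (V h B) (P (A ++ D ∷ B)))))

    private
      by : ∀ {b b′ x} → b ≡ b′ → when b x ≈ when b′ x
      by b≡b′ = reflexive (≡.cong (λ b → when b _) b≡b′)

      Σ-above-axis : ∀ L k (P : List Step → Carrier) →
        Σ-words (suc L) (λ v → when (V (suc k) v) (P v))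
          ≈ Σ-words L (λ v → when (V (2 ℕ.+ k) v) (P (U ∷ v))) + Σ-words L (λ v → when (V k v) (P (D ∷ v)))
      Σ-above-axis L k P =
        trans (Σ-words-suc L (λ v → when (V (suc k) v) (P v)))
              (+-cong (Σ-list-cong (words L) (λ v → by (V-U k v)))
                      (trans (+-cong (Σ-list-cong (words L) (λ v → by (V-D k v)))
                                     (trans (Σ-list-cong (words L) (λ v → by (V-H k v))) (Σ-list-0 (words L))))
                             (+-identityʳ _)))

      returns-suc₀ : ∀ h P m r → returns 0 h P (suc m) r ≈ returns 1 h (P ∘ (U ∷_)) m r
      returns-suc₀ h P m r =
        trans (Σ-words-suc m _) (trans (+-congˡ (+-cong (Σ-list-0 (words m)) (Σ-list-0 (words m))))
                                       (trans (+-congˡ (+-identityˡ 0#)) (+-identityʳ _)))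

      returns-suc : ∀ g h P m r →
        returns (suc g) h P (suc m) r ≈ returns (suc (suc g)) h (P ∘ (U ∷_)) m r + returns g h (P ∘ (D ∷_)) m r
      returns-suc g h P m r =
        trans (Σ-words-suc m _) (+-congˡ (trans (+-congˡ (Σ-list-0 (words m))) (+-identityʳ _)))

    first-return : ∀ L g h P →
      Σ-words L (λ v → when (V (suc (g ℕ.+ h)) v) (P v)) ≈ Σsplit L (returns g h P)
    first-return zero    g h P = trans (+-congʳ (by (V-[] (g ℕ.+ h)))) (+-identityˡ 0#)
    first-return (suc L) g h P = begin
      Σ-words (suc L) (λ v → when (V (suc (g ℕ.+ h)) v) (P v))
        ≈⟨ Σ-above-axis L (g ℕ.+ h) P ⟩
      Σ-words L (λ v → when (V (suc (suc g ℕ.+ h)) v) (P (U ∷ v)))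
        + Σ-words L (λ v → when (V (g ℕ.+ h) v) (P (D ∷ v)))
        ≈⟨ +-congʳ (first-return L (suc g) h (P ∘ (U ∷_))) ⟩
      Σsplit L (returns (suc g) h (P ∘ (U ∷_))) + Σ-words L (λ v → when (V (g ℕ.+ h) v) (P (D ∷ v)))
        ≈⟨ descend g ⟩
      Σsplit (suc L) (returns g h P) ∎
      where
      descend : ∀ g → Σsplit L (returns (suc g) h (P ∘ (U ∷_))) + Σ-words L (λ v → when (V (g ℕ.+ h) v) (P (D ∷ v)))
                        ≈ Σsplit (suc L) (returns g h P)
      descend zero = trans (+-comm _ _) (+-cong (sym (+-identityʳ _)) (sym (Σsplit-cong L (returns-suc₀ h P))))
      descend (suc g) = begin
        Σsplit L (returns (2 ℕ.+ g) h (P ∘ (U ∷_))) + Σ-words L (λ v → when (V (suc (g ℕ.+ h)) v) (P (D ∷ v)))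
          ≈⟨ +-congˡ (first-return L g h (P ∘ (D ∷_))) ⟩
        Σsplit L (returns (2 ℕ.+ g) h (P ∘ (U ∷_))) + Σsplit L (returns g h (P ∘ (D ∷_)))
          ≈⟨ Σsplit-+ L _ _ ⟨
        Σsplit L (λ m r → returns (2 ℕ.+ g) h (P ∘ (U ∷_)) m r + returns g h (P ∘ (D ∷_)) m r)
          ≈⟨ Σsplit-cong L (returns-suc g h P) ⟨
        Σsplit L (λ m r → returns (suc g) h P (suc m) r)
          ≈⟨ trans (+-congʳ (+-identityʳ 0#)) (+-identityˡ _) ⟨
        Σsplit (suc L) (returns (suc g) h P) ∎

  module DispersedReturn = FirstReturn validFrom (λ _ → ≡.refl) (λ _ _ → ≡.refl) (λ _ _ → ≡.refl) (λ _ _ → ≡.refl)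
  module DyckReturn = FirstReturn dyckFrom (λ _ → ≡.refl) (λ _ _ → ≡.refl) (λ _ _ → ≡.refl) (λ _ _ → ≡.refl)

  dispersed-first-return : ∀ n P →
    Σ-words (suc n) (λ w → when (validFrom 0 w) (P w))
      ≈ Σ-words n (λ w → when (validFrom 0 w) (P (H ∷ w))) + Σsplit n (DispersedReturn.returns 0 0 (P ∘ (U ∷_)))
  dispersed-first-return n P =
    trans (Σ-words-suc n _)
          (trans (+-cong (DispersedReturn.first-return n 0 0 (P ∘ (U ∷_)))
                         (trans (+-congʳ (Σ-list-0 (words n))) (+-identityˡ _)))
                 (+-comm _ _))

  dyck-first-return : ∀ n P →
    Σ-words (suc n) (λ w → when (dyckFrom 0 w) (P w)) ≈ Σsplit n (DyckReturn.returns 0 0 (P ∘ (U ∷_)))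
  dyck-first-return n P =
    trans (Σ-words-suc n _)
          (trans (+-congˡ (trans (+-cong (Σ-list-0 (words n)) (Σ-list-0 (words n))) (+-identityˡ 0#)))
                 (trans (+-identityʳ _) (DyckReturn.first-return n 0 0 (P ∘ (U ∷_)))))

-- Functional equations for paths

module PathSeries {c ℓ} (R : CommutativeRing c ℓ) where

  open CommutativeRing R hiding (zero)
  open WordSums semiring
  open PowerSeries R
  open import Algebra.Properties.Ring ring using (-0#≈0#)
  open import Algebra.Properties.Semiring.Exp semiring using (_^_; ^-congʳ; ^-homo-*)
  open import Algebra.Properties.Semiring.Mult semiring as Mult using (×-homo-+)
  open import Relation.Binary.Reasoning.Setoid setoid

  Σsplit-⊛ : ∀ n f g → Σsplit n (λ m r → f m * g r) ≈ (X ⊛ (f ⊛ g)) n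
  Σsplit-⊛ zero    f g = sym (X-⊛-zero (f ⊛ g))
  Σsplit-⊛ (suc n) f g = trans (unfold n f) (sym (X-⊛-suc (f ⊛ g) n))
    where
    unfold : ∀ n f → Σsplit (suc n) (λ m r → f m * g r) ≈ (f ⊛ g) n
    unfold zero    f = +-identityʳ _
    unfold (suc n) f = +-congˡ (unfold n (f ∘ suc))

  Σsplit-⊕ : ∀ n {F G u v} → Σsplit n F ≈ (X ⊛ u) n → Σsplit n G ≈ (X ⊛ v) n →
    Σsplit n (λ m r → F m r + G m r) ≈ (X ⊛ (u ⊕ v)) n
  Σsplit-⊕ n {F} {G} {u} {v} F≈ G≈ =
    trans (Σsplit-+ n F G) (trans (+-cong F≈ G≈) (sym (⊛-distribˡ X u v n)))

  1^n≈1 : ∀ n → 1# ^ n ≈ 1#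
  1^n≈1 zero    = refl
  1^n≈1 (suc n) = trans (*-identityˡ _) (1^n≈1 n)

  ι : ℕ → Carrier
  ι n = n Mult.× 1#

  ι-+ : ∀ m n → ι (m ℕ.+ n) ≈ ι m * 1# ^ n + 1# ^ m * ι n
  ι-+ m n = trans (×-homo-+ 1# m n)
    (sym (+-cong (trans (*-congˡ (1^n≈1 n)) (*-identityʳ _)) (trans (*-congʳ (1^n≈1 m)) (*-identityˡ _))))

  ⊖𝟙-suc : ∀ f m → (f ⊕ ⊖ 𝟙) (suc m) ≈ f (suc m)
  ⊖𝟙-suc f m = trans (+-congˡ -0#≈0#) (+-identityʳ _)

  private
    pick-first : ∀ {b} x y → b ≈ 0# → x ≈ 1# * x + b * y
    pick-first x y b≈0 = sym (trans (+-cong (*-identityˡ x) (trans (*-congʳ b≈0) (zeroˡ y))) (+-identityʳ x))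

    pick-second : ∀ {b x} y w → b ≈ x → x * y ≈ 0# * w + b * y
    pick-second y w b≈x = sym (trans (+-cong (zeroˡ w) (*-congʳ b≈x)) (+-identityˡ _))

    pick-first₂ : ∀ {b b′} x y y′ → b ≈ 0# → b′ ≈ 0# → x ≈ 1# * x + (b * y + b′ * y′)
    pick-first₂ {b} {b′} x y y′ b≈0 b′≈0 = trans (pick-first x 1# (trans (+-cong kill kill′) (+-identityˡ 0#)))
                                                  (+-congˡ (*-identityʳ _))
      where
      kill : b * y ≈ 0#
      kill = trans (*-congʳ b≈0) (zeroˡ y)
      kill′ : b′ * y′ ≈ 0#
      kill′ = trans (*-congʳ b′≈0) (zeroˡ y′)

    pick-second₂ : ∀ {b′ x′} x y y′ w → b′ ≈ x′ → x * y + x′ * y′ ≈ 0# * w + (x * y + b′ * y′)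
    pick-second₂ x y y′ w b′≈x′ = sym (trans (+-cong (zeroˡ w) (+-congˡ (*-congʳ b′≈x′))) (+-identityˡ _))

  module _ (τ : Carrier) where

    dispersedGF dyckGF : Series
    dispersedGF n = Σ-words n (λ w → when (validFrom 0 w) (τ ^ oneDesc w))
    dyckGF      n = Σ-words n (λ w → when (dyckFrom 0 w) (τ ^ closedOneDesc w))

    nonemptyDyck-zero : (dyckGF ⊕ ⊖ 𝟙) 0 ≈ 0#
    nonemptyDyck-zero = trans (+-congʳ (+-identityʳ 1#)) (-‿inverseʳ 1#)

    dispersed-returns : ∀ m r →
      DispersedReturn.returns 0 0 (λ w → τ ^ oneDesc w) m r ≈ (const τ ⊕ (dyckGF ⊕ ⊖ 𝟙)) m * dispersedGF r
    dispersed-returns zero r = begin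
      Σ-words 0 (λ A → when (dyckFrom 0 A) (Σ-words r (λ B → when (validFrom 0 B) (τ ^ oneDesc (A ++ D ∷ B)))))
        ≈⟨ +-identityʳ _ ⟩
      Σ-words r (λ B → when (validFrom 0 B) (τ ^ run single B))
        ≈⟨ Σ-list-cong (words r) (λ B → when-cong (validFrom 0 B) (λ disp →
             ^-congʳ τ (run-single B (dispersed-head B disp)))) ⟩
      Σ-words r (λ B → when (validFrom 0 B) (τ * τ ^ oneDesc B))
        ≈⟨ Σ-list-cong (words r) (λ B → when-*ˡ (validFrom 0 B) τ _) ⟩
      Σ-words r (λ B → τ * when (validFrom 0 B) (τ ^ oneDesc B))
        ≈⟨ Σ-list-*ˡ (words r) τ _ ⟩
      τ * dispersedGF r
        ≈⟨ *-congʳ (trans (+-congˡ nonemptyDyck-zero) (+-identityʳ τ)) ⟨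
      (τ + (dyckGF ⊕ ⊖ 𝟙) 0) * dispersedGF r ∎
    dispersed-returns (suc m) r = begin
      Σ-words (suc m) (λ A → when (dyckFrom 0 A) (Σ-words r (λ B → when (validFrom 0 B) (τ ^ oneDesc (A ++ D ∷ B)))))
        ≈⟨ Σ-nested-suc-cong m r (dyckFrom 0) (validFrom 0) (λ x A B dyck disp →
             trans (^-congʳ τ (oneDesc-return x A B dyck (dispersed-head B disp)))
                   (^-homo-* τ (closedOneDesc (x ∷ A)) (oneDesc B))) ⟩
      Σ-words (suc m) (λ A → when (dyckFrom 0 A) (Σ-words r (λ B → when (validFrom 0 B)
        (τ ^ closedOneDesc A * τ ^ oneDesc B))))
        ≈⟨ Σ-words-product (suc m) r (dyckFrom 0) (validFrom 0) _ _ ⟩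
      dyckGF (suc m) * dispersedGF r
        ≈⟨ *-congʳ (trans (+-identityˡ _) (⊖𝟙-suc dyckGF m)) ⟨
      (0# + (dyckGF ⊕ ⊖ 𝟙) (suc m)) * dispersedGF r ∎

    dyck-first-step : ∀ r →
      Σ-words r (λ B → when (dyckFrom 0 B) (τ ^ closed single B)) ≈ (𝟙 ⊕ const τ ⊛ (dyckGF ⊕ ⊖ 𝟙)) r
    dyck-first-step zero    = +-congˡ (sym (trans (*-congˡ nonemptyDyck-zero) (zeroʳ τ)))
    dyck-first-step (suc r) = begin
      Σ-words (suc r) (λ B → when (dyckFrom 0 B) (τ ^ closed single B))
        ≈⟨ Σ-words-suc-cong r (λ x B → when-cong (dyckFrom 0 (x ∷ B)) (λ dyck →
             ^-congʳ τ (closed-single x B (dyck-head (x ∷ B) dyck)))) ⟩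
      Σ-words (suc r) (λ B → when (dyckFrom 0 B) (τ * τ ^ closedOneDesc B))
        ≈⟨ Σ-list-cong (words (suc r)) (λ B → when-*ˡ (dyckFrom 0 B) τ _) ⟩
      Σ-words (suc r) (λ B → τ * when (dyckFrom 0 B) (τ ^ closedOneDesc B))
        ≈⟨ Σ-list-*ˡ (words (suc r)) τ _ ⟩
      τ * dyckGF (suc r)
        ≈⟨ *-congˡ (⊖𝟙-suc dyckGF r) ⟨
      τ * (dyckGF ⊕ ⊖ 𝟙) (suc r)
        ≈⟨ const-⊛ τ (dyckGF ⊕ ⊖ 𝟙) (suc r) ⟨
      (const τ ⊛ (dyckGF ⊕ ⊖ 𝟙)) (suc r)
        ≈⟨ +-identityˡ _ ⟨
      (𝟙 ⊕ const τ ⊛ (dyckGF ⊕ ⊖ 𝟙)) (suc r) ∎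

    dyck-returns : ∀ m r →
      DyckReturn.returns 0 0 (λ w → τ ^ closedOneDesc w) m r
        ≈ 𝟙 m * (𝟙 ⊕ const τ ⊛ (dyckGF ⊕ ⊖ 𝟙)) r + (dyckGF ⊕ ⊖ 𝟙) m * dyckGF r
    dyck-returns zero r =
      trans (+-identityʳ _) (trans (dyck-first-step r) (pick-first _ (dyckGF r) nonemptyDyck-zero))
    dyck-returns (suc m) r = begin
      Σ-words (suc m) (λ A → when (dyckFrom 0 A) (Σ-words r (λ B → when (dyckFrom 0 B) (τ ^ closedOneDesc (A ++ D ∷ B)))))
        ≈⟨ Σ-nested-suc-cong m r (dyckFrom 0) (dyckFrom 0) (λ x A B dyckA dyckB →
             trans (^-congʳ τ (closedOneDesc-return x A B dyckA (dyck-head B dyckB)))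
                   (^-homo-* τ (closedOneDesc (x ∷ A)) (closedOneDesc B))) ⟩
      Σ-words (suc m) (λ A → when (dyckFrom 0 A) (Σ-words r (λ B → when (dyckFrom 0 B)
        (τ ^ closedOneDesc A * τ ^ closedOneDesc B))))
        ≈⟨ Σ-words-product (suc m) r (dyckFrom 0) (dyckFrom 0) _ _ ⟩
      dyckGF (suc m) * dyckGF r
        ≈⟨ pick-second (dyckGF r) _ (⊖𝟙-suc dyckGF m) ⟩
      0# * (𝟙 ⊕ const τ ⊛ (dyckGF ⊕ ⊖ 𝟙)) r + (dyckGF ⊕ ⊖ 𝟙) (suc m) * dyckGF r ∎

    dispersedGF-equation :
      dispersedGF ≋ 𝟙 ⊕ X ⊛ (dispersedGF ⊕ X ⊛ ((const τ ⊕ (dyckGF ⊕ ⊖ 𝟙)) ⊛ dispersedGF))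
    dispersedGF-equation = series-by-shift (+-identityʳ 1#) λ n →
      trans (dispersed-first-return n _)
            (+-congˡ (trans (Σsplit-cong n dispersed-returns) (Σsplit-⊛ n _ _)))

    dyckGF-equation :
      dyckGF ≋ 𝟙 ⊕ X ⊛ (X ⊛ (𝟙 ⊛ (𝟙 ⊕ const τ ⊛ (dyckGF ⊕ ⊖ 𝟙)) ⊕ (dyckGF ⊕ ⊖ 𝟙) ⊛ dyckGF))
    dyckGF-equation = series-by-shift (+-identityʳ 1#) λ n →
      trans (dyck-first-return n _)
            (trans (Σsplit-cong n dyck-returns) (Σsplit-⊕ n (Σsplit-⊛ n _ _) (Σsplit-⊛ n _ _)))

  dispersedTotal dyckTotal : Series
  dispersedTotal n = Σ-words n (λ w → when (validFrom 0 w) (ι (oneDesc w)))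
  dyckTotal      n = Σ-words n (λ w → when (dyckFrom 0 w) (ι (closedOneDesc w)))

  private
    Σ-1+ι : ∀ n (a : List Step → Bool) (k : List Step → ℕ) →
      Σ-words n (λ w → when (a w) (1# + ι (k w)))
        ≈ Σ-words n (λ w → when (a w) (1# ^ k w)) + Σ-words n (λ w → when (a w) (ι (k w)))
    Σ-1+ι n a k = trans (Σ-list-cong (words n) (λ w →
                           trans (when-cong (a w) (λ _ → +-congʳ (sym (1^n≈1 (k w))))) (when-+ (a w) _ _)))
                         (Σ-list-+ (words n) _ _)

    dyckTotal-zero : dyckTotal 0 ≈ 0#
    dyckTotal-zero = +-identityʳ 0#

  dispersedTotal-returns : ∀ m r →
    DispersedReturn.returns 0 0 (λ w → ι (oneDesc w)) m r
      ≈ 𝟙 m * (dispersedGF 1# ⊕ dispersedTotal) r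
        + (dyckTotal m * dispersedGF 1# r + (dyckGF 1# ⊕ ⊖ 𝟙) m * dispersedTotal r)
  dispersedTotal-returns zero r = begin
    Σ-words 0 (λ A → when (dyckFrom 0 A) (Σ-words r (λ B → when (validFrom 0 B) (ι (oneDesc (A ++ D ∷ B))))))
      ≈⟨ +-identityʳ _ ⟩
    Σ-words r (λ B → when (validFrom 0 B) (ι (run single B)))
      ≈⟨ Σ-list-cong (words r) (λ B → when-cong (validFrom 0 B) (λ disp →
           reflexive (≡.cong ι (run-single B (dispersed-head B disp))))) ⟩
    Σ-words r (λ B → when (validFrom 0 B) (1# + ι (oneDesc B)))
      ≈⟨ Σ-1+ι r (validFrom 0) oneDesc ⟩
    dispersedGF 1# r + dispersedTotal r
      ≈⟨ pick-first₂ _ _ _ dyckTotal-zero (nonemptyDyck-zero 1#) ⟩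
    1# * (dispersedGF 1# r + dispersedTotal r)
      + (dyckTotal 0 * dispersedGF 1# r + (dyckGF 1# ⊕ ⊖ 𝟙) 0 * dispersedTotal r) ∎
  dispersedTotal-returns (suc m) r = begin
    Σ-words (suc m) (λ A → when (dyckFrom 0 A) (Σ-words r (λ B → when (validFrom 0 B) (ι (oneDesc (A ++ D ∷ B))))))
      ≈⟨ Σ-nested-suc-cong m r (dyckFrom 0) (validFrom 0) (λ x A B dyck disp →
           trans (reflexive (≡.cong ι (oneDesc-return x A B dyck (dispersed-head B disp))))
                 (ι-+ (closedOneDesc (x ∷ A)) (oneDesc B))) ⟩
    Σ-words (suc m) (λ A → when (dyckFrom 0 A) (Σ-words r (λ B → when (validFrom 0 B)
      (ι (closedOneDesc A) * 1# ^ oneDesc B + 1# ^ closedOneDesc A * ι (oneDesc B)))))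
      ≈⟨ Σ-nested-+ (suc m) r (dyckFrom 0) (validFrom 0) _ _ ⟩
    _ + _
      ≈⟨ +-cong (Σ-words-product (suc m) r (dyckFrom 0) (validFrom 0) _ _)
                (Σ-words-product (suc m) r (dyckFrom 0) (validFrom 0) _ _) ⟩
    dyckTotal (suc m) * dispersedGF 1# r + dyckGF 1# (suc m) * dispersedTotal r
      ≈⟨ pick-second₂ _ _ _ _ (⊖𝟙-suc (dyckGF 1#) m) ⟩
    0# * (dispersedGF 1# r + dispersedTotal r)
      + (dyckTotal (suc m) * dispersedGF 1# r + (dyckGF 1# ⊕ ⊖ 𝟙) (suc m) * dispersedTotal r) ∎

  dyckTotal-first-step : ∀ r →
    Σ-words r (λ B → when (dyckFrom 0 B) (ι (closed single B))) ≈ ((dyckGF 1# ⊕ ⊖ 𝟙) ⊕ dyckTotal) r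
  dyckTotal-first-step zero    =
    trans (+-identityʳ 0#) (sym (trans (+-cong (nonemptyDyck-zero 1#) dyckTotal-zero) (+-identityʳ 0#)))
  dyckTotal-first-step (suc r) = begin
    Σ-words (suc r) (λ B → when (dyckFrom 0 B) (ι (closed single B)))
      ≈⟨ Σ-words-suc-cong r (λ x B → when-cong (dyckFrom 0 (x ∷ B)) (λ dyck →
           reflexive (≡.cong ι (closed-single x B (dyck-head (x ∷ B) dyck))))) ⟩
    Σ-words (suc r) (λ B → when (dyckFrom 0 B) (1# + ι (closedOneDesc B)))
      ≈⟨ Σ-1+ι (suc r) (dyckFrom 0) closedOneDesc ⟩
    dyckGF 1# (suc r) + dyckTotal (suc r)
      ≈⟨ +-congʳ (⊖𝟙-suc (dyckGF 1#) r) ⟨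
    (dyckGF 1# ⊕ ⊖ 𝟙) (suc r) + dyckTotal (suc r) ∎

  dyckTotal-returns : ∀ m r →
    DyckReturn.returns 0 0 (λ w → ι (closedOneDesc w)) m r
      ≈ 𝟙 m * ((dyckGF 1# ⊕ ⊖ 𝟙) ⊕ dyckTotal) r
        + (dyckTotal m * dyckGF 1# r + (dyckGF 1# ⊕ ⊖ 𝟙) m * dyckTotal r)
  dyckTotal-returns zero r =
    trans (+-identityʳ _) (trans (dyckTotal-first-step r)
                                 (pick-first₂ _ _ _ dyckTotal-zero (nonemptyDyck-zero 1#)))
  dyckTotal-returns (suc m) r = begin
    Σ-words (suc m) (λ A → when (dyckFrom 0 A) (Σ-words r (λ B → when (dyckFrom 0 B) (ι (closedOneDesc (A ++ D ∷ B))))))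
      ≈⟨ Σ-nested-suc-cong m r (dyckFrom 0) (dyckFrom 0) (λ x A B dyckA dyckB →
           trans (reflexive (≡.cong ι (closedOneDesc-return x A B dyckA (dyck-head B dyckB))))
                 (ι-+ (closedOneDesc (x ∷ A)) (closedOneDesc B))) ⟩
    Σ-words (suc m) (λ A → when (dyckFrom 0 A) (Σ-words r (λ B → when (dyckFrom 0 B)
      (ι (closedOneDesc A) * 1# ^ closedOneDesc B + 1# ^ closedOneDesc A * ι (closedOneDesc B)))))
      ≈⟨ Σ-nested-+ (suc m) r (dyckFrom 0) (dyckFrom 0) _ _ ⟩
    _ + _
      ≈⟨ +-cong (Σ-words-product (suc m) r (dyckFrom 0) (dyckFrom 0) _ _)
                (Σ-words-product (suc m) r (dyckFrom 0) (dyckFrom 0) _ _) ⟩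
    dyckTotal (suc m) * dyckGF 1# r + dyckGF 1# (suc m) * dyckTotal r
      ≈⟨ pick-second₂ _ _ _ _ (⊖𝟙-suc (dyckGF 1#) m) ⟩
    0# * ((dyckGF 1# ⊕ ⊖ 𝟙) ⊕ dyckTotal) r
      + (dyckTotal (suc m) * dyckGF 1# r + (dyckGF 1# ⊕ ⊖ 𝟙) (suc m) * dyckTotal r) ∎

  dispersedTotal-equation :
    dispersedTotal ≋ const 0# ⊕ X ⊛ (dispersedTotal ⊕ X ⊛ (𝟙 ⊛ (dispersedGF 1# ⊕ dispersedTotal)
                       ⊕ (dyckTotal ⊛ dispersedGF 1# ⊕ (dyckGF 1# ⊕ ⊖ 𝟙) ⊛ dispersedTotal)))
  dispersedTotal-equation = series-by-shift (+-identityʳ 0#) λ n →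
    trans (dispersed-first-return n _)
          (+-congˡ (trans (Σsplit-cong n dispersedTotal-returns)
                          (Σsplit-⊕ n (Σsplit-⊛ n _ _) (Σsplit-⊕ n (Σsplit-⊛ n _ _) (Σsplit-⊛ n _ _)))))

  dyckTotal-equation :
    dyckTotal ≋ const 0# ⊕ X ⊛ (X ⊛ (𝟙 ⊛ ((dyckGF 1# ⊕ ⊖ 𝟙) ⊕ dyckTotal)
                  ⊕ (dyckTotal ⊛ dyckGF 1# ⊕ (dyckGF 1# ⊕ ⊖ 𝟙) ⊛ dyckTotal)))
  dyckTotal-equation = series-by-shift (+-identityʳ 0#) λ n →
    trans (dyck-first-return n _)
          (trans (Σsplit-cong n dyckTotal-returns)
                 (Σsplit-⊕ n (Σsplit-⊛ n _ _) (Σsplit-⊕ n (Σsplit-⊛ n _ _) (Σsplit-⊛ n _ _))))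

-- Rational coefficients and the series of the statement

module Coefficients {c ℓ} (R : CommutativeRing c ℓ) where

  open CommutativeRing R
  open PowerSeries R
  module W₀ = WordSums semiring
  module W₁ = WordSums (CommutativeRing.semiring seriesRing)
  open import Algebra.Properties.Semiring.Exp (CommutativeRing.semiring seriesRing) using (_^_)

  Σ-list-coeff : ∀ {a} {A : Set a} (xs : List A) f k → W₁.Σ-list xs f k ≈ W₀.Σ-list xs (λ x → f x k)
  Σ-list-coeff []       f k = refl
  Σ-list-coeff (x ∷ xs) f k = +-congˡ (Σ-list-coeff xs f k)

  when-coeff : ∀ b x k → W₁.when b x k ≈ W₀.when b (x k)
  when-coeff true  x k = refl
  when-coeff false x k = refl

  X^-coeff : ∀ m k → (X ^ m) k ≈ W₀.when (m ℕ.≡ᵇ k) 1#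
  X^-coeff zero    zero    = refl
  X^-coeff zero    (suc k) = refl
  X^-coeff (suc m) zero    = X-⊛-zero (X ^ m)
  X^-coeff (suc m) (suc k) = trans (X-⊛-suc (X ^ m) k) (X^-coeff m k)

ℚ-ring : CommutativeRing _ _
ℚ-ring = ℚP.+-*-commutativeRing

module Series₁ = PowerSeries ℚ-ring
module Series₂ = PowerSeries Series₁.seriesRing

ℚ-coefficients : RawRing _ _
ℚ-coefficients = AlmostCommutativeRing.rawRing (fromCommutativeRing ℚ-ring)

ℚ-identity : ℚ-coefficients -Raw-AlmostCommutative⟶ fromCommutativeRing ℚ-ring
ℚ-identity = -raw-almostCommutative⟶ (fromCommutativeRing ℚ-ring)

module Solver₁ = RingSolver ℚ-coefficients (fromCommutativeRing Series₁.seriesRing)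
  (Series₁.liftMorphism ℚ-identity) (Series₁.liftCoeff≟ ℚ-identity (dec⇒weaklyDec ℚP._≟_))

module Solver₂ = RingSolver ℚ-coefficients (fromCommutativeRing Series₂.seriesRing)
  (Series₂.liftMorphism (Series₁.liftMorphism ℚ-identity))
  (Series₂.liftCoeff≟ (Series₁.liftMorphism ℚ-identity) (Series₁.liftCoeff≟ ℚ-identity (dec⇒weaklyDec ℚP._≟_)))

module _ where
  open import Data.Integer using (+_)
  open import Data.Nat.Coprimality using (1-coprimeTo) renaming (sym to coprime-sym)
  open ≡.≡-Reasoning

  private
    integer : ℕ → ℚ
    integer n = ℚ.mkℚ (+ n) 0 (coprime-sym (1-coprimeTo n))

    fromℕ≡integer : ∀ n → fromℕ n ≡ integer n
    fromℕ≡integer n = ℚP.normalize-coprime (coprime-sym (1-coprimeTo n))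

    -- both sides normalise to the same fraction
    1+integer : ∀ n → 1ℚ ℚ.+ integer n ≡ fromℕ (suc (n ℕ.* 1))
    1+integer zero    = ≡.refl
    1+integer (suc n) = ≡.refl

  fromℕ-suc : ∀ n → fromℕ (suc n) ≡ 1ℚ ℚ.+ fromℕ n
  fromℕ-suc n = begin
    fromℕ (suc n)          ≡⟨ ≡.cong (fromℕ ∘ suc) (ℕP.*-identityʳ n) ⟨
    fromℕ (suc (n ℕ.* 1))  ≡⟨ 1+integer n ⟨
    1ℚ ℚ.+ integer n       ≡⟨ ≡.cong (1ℚ ℚ.+_) (fromℕ≡integer n) ⟨
    1ℚ ℚ.+ fromℕ n         ∎

  fromℕ-+ : ∀ m n → fromℕ (m ℕ.+ n) ≡ fromℕ m ℚ.+ fromℕ n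
  fromℕ-+ zero    n = ≡.sym (ℚP.+-identityˡ (fromℕ n))
  fromℕ-+ (suc m) n = begin
    fromℕ (suc (m ℕ.+ n))              ≡⟨ fromℕ-suc (m ℕ.+ n) ⟩
    1ℚ ℚ.+ fromℕ (m ℕ.+ n)             ≡⟨ ≡.cong (1ℚ ℚ.+_) (fromℕ-+ m n) ⟩
    1ℚ ℚ.+ (fromℕ m ℚ.+ fromℕ n)       ≡⟨ ℚP.+-assoc 1ℚ (fromℕ m) (fromℕ n) ⟨
    (1ℚ ℚ.+ fromℕ m) ℚ.+ fromℕ n       ≡⟨ ≡.cong (ℚ._+ fromℕ n) (fromℕ-suc m) ⟨
    fromℕ (suc m) ℚ.+ fromℕ n          ∎

module ℚ-sums = WordSums (CommutativeRing.semiring ℚ-ring)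

module _ where
  open ℚ-sums
  open import Data.Bool using (T?)
  open import Data.Nat.ListAction using (sum)

  count-filter : ∀ xs (p q : List Step → Bool) →
    fromℕ (length (filter (λ w → T? (p w)) (filter (λ w → T? (q w)) xs)))
      ≡ Σ-list xs (λ w → when (q w) (when (p w) 1ℚ))
  count-filter []       p q = ≡.refl
  count-filter (x ∷ xs) p q with q x
  ... | false = ≡.trans (count-filter xs p q) (≡.sym (ℚP.+-identityˡ _))
  ... | true with p x
  ...   | false = ≡.trans (count-filter xs p q) (≡.sym (ℚP.+-identityˡ _))
  ...   | true  = ≡.trans (fromℕ-suc (length (filter (λ w → T? (p w)) (filter (λ w → T? (q w)) xs))))
                          (≡.cong (1ℚ ℚ.+_) (count-filter xs p q))

  sum-filter : ∀ xs (q : List Step → Bool) (f : List Step → ℕ) →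
    fromℕ (sum (map f (filter (λ w → T? (q w)) xs))) ≡ Σ-list xs (λ w → when (q w) (fromℕ (f w)))
  sum-filter []       q f = ≡.refl
  sum-filter (x ∷ xs) q f with q x
  ... | false = ≡.trans (sum-filter xs q f) (≡.sym (ℚP.+-identityˡ _))
  ... | true  = ≡.trans (fromℕ-+ (f x) _) (≡.cong (fromℕ (f x) ℚ.+_) (sum-filter xs q f))

module _ where

  Σ≤-front : ∀ n F → Σ≤ (suc n) F ≡ F 0 ℚ.+ Σ≤ n (F ∘ suc)
  Σ≤-front zero    F = ≡.refl
  Σ≤-front (suc n) F = ≡.trans (≡.cong (ℚ._+ F (2 ℕ.+ n)) (Σ≤-front n F)) (ℚP.+-assoc (F 0) _ _)

  *-agrees₁ : ∀ f g → f S1.* g Series₁.≋ f Series₁.⊛ g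
  *-agrees₁ f g zero    = ≡.refl
  *-agrees₁ f g (suc n) =
    ≡.trans (Σ≤-front n _) (≡.cong (f 0 ℚ.* g (suc n) ℚ.+_) (*-agrees₁ (f ∘ suc) g n))

  *-agrees₂ : ∀ f g → f S2.* g Series₂.≋ f Series₂.⊛ g
  *-agrees₂ f g zero    k = *-agrees₁ (f 0) (g 0) k
  *-agrees₂ f g (suc n) k =
    ≡.trans (Σ≤-front n _) (≡.cong₂ ℚ._+_ (*-agrees₁ (f 0) (g (suc n)) k) (*-agrees₂ (f ∘ suc) g n k))

module Agree₁ where
  open Series₁ using (_≋_; _⊕_; ⊖_; _⊛_; X; ⊛-cong)

  * : ∀ {f f′ g g′} → f ≋ f′ → g ≋ g′ → f S1.* g ≋ f′ ⊛ g′
  * {f} {f′} {g} {g′} f≋f′ g≋g′ n = ≡.trans (*-agrees₁ f g n) (⊛-cong f≋f′ g≋g′ n)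

  + : ∀ {f f′ g g′} → f ≋ f′ → g ≋ g′ → f S1.+ g ≋ f′ ⊕ g′
  + f≋f′ g≋g′ n = ≡.cong₂ ℚ._+_ (f≋f′ n) (g≋g′ n)

  - : ∀ {f f′ g g′} → f ≋ f′ → g ≋ g′ → f S1.- g ≋ f′ ⊕ ⊖ g′
  - f≋f′ g≋g′ n = ≡.cong₂ ℚ._-_ (f≋f′ n) (g≋g′ n)

  z : S1.z ≋ X
  z zero          = ≡.refl
  z (suc zero)    = ≡.refl
  z (suc (suc n)) = ≡.refl

  const : ∀ a → S1.const a ≋ Series₁.const a
  const a zero    = ≡.refl
  const a (suc n) = ≡.refl

module Agree₂ where
  open Series₂ using (_≋_; _⊕_; ⊖_; _⊛_; X; ⊛-cong)

  * : ∀ {f f′ g g′} → f ≋ f′ → g ≋ g′ → f S2.* g ≋ f′ ⊛ g′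
  * {f} {f′} {g} {g′} f≋f′ g≋g′ n k = ≡.trans (*-agrees₂ f g n k) (⊛-cong f≋f′ g≋g′ n k)

  + : ∀ {f f′ g g′} → f ≋ f′ → g ≋ g′ → f S2.+ g ≋ f′ ⊕ g′
  + f≋f′ g≋g′ n k = ≡.cong₂ ℚ._+_ (f≋f′ n k) (g≋g′ n k)

  - : ∀ {f f′ g g′} → f ≋ f′ → g ≋ g′ → f S2.- g ≋ f′ ⊕ ⊖ g′
  - f≋f′ g≋g′ n k = ≡.cong₂ ℚ._-_ (f≋f′ n k) (g≋g′ n k)

  z : S2.z ≋ X
  z zero          k       = ≡.refl
  z (suc zero)    zero    = ≡.refl
  z (suc zero)    (suc k) = ≡.refl
  z (suc (suc n)) k       = ≡.refl

  t : S2.t ≋ Series₂.const Series₁.X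
  t zero    zero          = ≡.refl
  t zero    (suc zero)    = ≡.refl
  t zero    (suc (suc k)) = ≡.refl
  t (suc n) k             = ≡.refl

  const : ∀ a → S2.const a ≋ Series₂.const (Series₁.const a)
  const a zero    zero    = ≡.refl
  const a zero    (suc k) = ≡.refl
  const a (suc n) k       = ≡.refl

module PathSeries₂ = PathSeries Series₁.seriesRing
module PathSeries₁ = PathSeries ℚ-ring

Φ-dispersedGF : Φ Series₂.≋ PathSeries₂.dispersedGF Series₁.X
Φ-dispersedGF n k = begin
  fromℕ (d n k)
    ≡⟨ count-filter (words n) (λ w → oneDesc w ℕ.≡ᵇ k) (validFrom 0) ⟩
  Σ-list (words n) (λ w → when (validFrom 0 w) (when (oneDesc w ℕ.≡ᵇ k) 1ℚ))
    ≡⟨ Σ-list-cong (words n) (λ w → ≡.sym (≡.trans (when-coeff (validFrom 0 w) _ k)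
                                                  (≡.cong (when (validFrom 0 w)) (X^-coeff (oneDesc w) k)))) ⟩
  Σ-list (words n) (λ w → W₁.when (validFrom 0 w) (X ^ oneDesc w) k)
    ≡⟨ Σ-list-coeff (words n) _ k ⟨
  PathSeries₂.dispersedGF Series₁.X n k ∎
  where
  open ≡.≡-Reasoning
  open ℚ-sums
  open Coefficients ℚ-ring
  open Series₁ using (X)
  open import Algebra.Properties.Semiring.Exp (CommutativeRing.semiring Series₁.seriesRing) using (_^_)

Ψ-dispersedTotal : Ψ Series₁.≋ PathSeries₁.dispersedTotal
Ψ-dispersedTotal n =
  ≡.trans (sum-filter (words n) (validFrom 0) oneDesc)
          (Σ-list-cong (words n) (λ w → ≡.cong (when (validFrom 0 w)) (≡.sym (ι≡fromℕ (oneDesc w)))))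
  where
  open ℚ-sums
  ι≡fromℕ : ∀ n → PathSeries₁.ι n ≡ fromℕ n
  ι≡fromℕ zero    = ≡.refl
  ι≡fromℕ (suc n) = ≡.trans (≡.cong (1ℚ ℚ.+_) (ι≡fromℕ n)) (≡.sym (fromℕ-suc n))

nonZero-regular : ∀ p .{{_ : ℚ.NonZero p}} → CommutativeRingLemmas.Regular ℚ-ring p
nonZero-regular p x xp≡0 = begin
  x                        ≡⟨ ℚP.*-identityʳ x ⟨
  x ℚ.* 1ℚ                 ≡⟨ ≡.cong (x ℚ.*_) (ℚP.*-inverseʳ p) ⟨
  x ℚ.* (p ℚ.* ℚ.1/ p)     ≡⟨ ℚP.*-assoc x p (ℚ.1/ p) ⟨
  (x ℚ.* p) ℚ.* ℚ.1/ p     ≡⟨ ≡.cong (ℚ._* ℚ.1/ p) xp≡0 ⟩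
  0ℚ ℚ.* ℚ.1/ p            ≡⟨ ℚP.*-zeroˡ (ℚ.1/ p) ⟩
  0ℚ                       ∎
  where open ≡.≡-Reasoning

constant-two-regular₁ : ∀ f → f 0 ≡ 1ℚ ℚ.+ 1ℚ → CommutativeRingLemmas.Regular Series₁.seriesRing f
constant-two-regular₁ f f0≡2 =
  Series₁.regular-by-constant-term (≡.subst (CommutativeRingLemmas.Regular ℚ-ring) (≡.sym f0≡2) (nonZero-regular (1ℚ ℚ.+ 1ℚ)))

constant-two-regular₂ : ∀ f → f 0 0 ≡ 1ℚ ℚ.+ 1ℚ → CommutativeRingLemmas.Regular Series₂.seriesRing f
constant-two-regular₂ f f00≡2 = Series₂.regular-by-constant-term (constant-two-regular₁ (f 0) f00≡2)

-- The two identities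

module DispersedPaths where

  open CommutativeRing Series₂.seriesRing
  open Series₂ using (Series; X; const; X-regular)
  open CommutativeRingLemmas Series₂.seriesRing
  open Solver₂ using (solve; _:=_; con; _:+_; _:*_; _:-_)
  open import Relation.Binary.Reasoning.Setoid setoid

  κ : ℚ → Series
  κ q = const (Series₁.const q)

  z t : Series
  z = X
  t = const Series₁.X

  F G : Series
  F = PathSeries₂.dispersedGF Series₁.X
  G = PathSeries₂.dyckGF Series₁.X

  F-equation : F ≈ 1# + z * (F + z * ((t + (G - 1#)) * F))
  F-equation = PathSeries₂.dispersedGF-equation Series₁.X

  G-equation : G ≈ 1# + z * (z * (1# * (1# + t * (G - 1#)) + (G - 1#) * G))
  G-equation = PathSeries₂.dyckGF-equation Series₁.X

  a rad den : Series
  a   = 1# + z * z - z * z * t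
  rad = 1# - κ (fromℕ 2) * (z * z) * t - κ (fromℕ 2) * (z * z) + (z * z) * (z * z) * t * t
          + κ (fromℕ 2) * ((z * z) * (z * z)) * t - κ (fromℕ 3) * ((z * z) * (z * z))
  den = 1# - κ (fromℕ 2) * z + z * z - z * z * z - z * z * t + z * z * z * t

  radicand-agrees : radicand ≈ rad
  radicand-agrees =
    A.- (A.+ (A.+ (A.- (A.- (A.const 1ℚ) (A.* (A.* (A.const (fromℕ 2)) z²) A.t)) (A.* (A.const (fromℕ 2)) z²))
                  (A.* (A.* z⁴ A.t) A.t))
             (A.* (A.* (A.const (fromℕ 2)) z⁴) A.t))
        (A.* (A.const (fromℕ 3)) z⁴)
    where
    module A = Agree₂
    z² : S2.z S2.* S2.z ≈ z * z
    z² = A.* A.z A.z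
    z⁴ : (S2.z S2.* S2.z) S2.* (S2.z S2.* S2.z) ≈ (z * z) * (z * z)
    z⁴ = A.* z² z²

  aPoly-agrees : aPoly ≈ a
  aPoly-agrees = A.- (A.+ (A.const 1ℚ) (A.* A.z A.z)) (A.* (A.* A.z A.z) A.t)
    where module A = Agree₂

  denomPoly-agrees : denomPoly ≈ den
  denomPoly-agrees =
    A.+ (A.- (A.- (A.+ (A.- (A.const 1ℚ) (A.* (A.const (fromℕ 2)) A.z)) z²) (A.* z² A.z)) (A.* z² A.t))
        (A.* (A.* z² A.z) A.t)
    where
    module A = Agree₂
    z² : S2.z S2.* S2.z ≈ z * z
    z² = A.* A.z A.z

  -- The paper's square root W, written through the Dyck series.
  V : Series
  V = a - κ (fromℕ 2) * z * (z * G)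

  V-squared : V * V ≈ rad
  V-squared = trans
    (solve 3 (λ z t g →
       let a = con 1ℚ :+ z :* z :- z :* z :* t
       in (a :- con (fromℕ 2) :* z :* (z :* g)) :* (a :- con (fromℕ 2) :* z :* (z :* g))
          := (con 1ℚ :- con (fromℕ 2) :* (z :* z) :* t :- con (fromℕ 2) :* (z :* z) :+ (z :* z) :* (z :* z) :* t :* t
              :+ con (fromℕ 2) :* ((z :* z) :* (z :* z)) :* t :- con (fromℕ 3) :* ((z :* z) :* (z :* z)))
             :+ con (ℚ.- fromℕ 4) :* (z :* z)
                :* (g :- (con 1ℚ :+ z :* (z :* (con 1ℚ :* (con 1ℚ :+ t :* (g :- con 1ℚ)) :+ (g :- con 1ℚ) :* g)))))
       (λ _ _ → ≡.refl) z t G)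
    (modulo rad _ G-equation)

  W-is-V : ∀ W → W * W ≈ rad → W 0 0 ≡ 1ℚ → W ≈ V
  W-is-V W W²≈rad W00≡1 =
    square-root-unique (constant-two-regular₂ (W + V) (≡.cong (ℚ._+ 1ℚ) W00≡1)) (trans W²≈rad (sym V-squared))

  r₂-is-zG : ∀ W r₂ → W ≈ V → κ (fromℕ 2) * z * r₂ ≈ a - W → r₂ ≈ z * G
  r₂-is-zG W r₂ W≈V 2zr₂≈a-W = regular-cancelʳ (regular-* (constant-two-regular₂ (κ (fromℕ 2)) ≡.refl) X-regular) (begin
    r₂ * (κ (fromℕ 2) * z)         ≈⟨ *-comm _ _ ⟩
    κ (fromℕ 2) * z * r₂           ≈⟨ 2zr₂≈a-W ⟩
    a - W                          ≈⟨ +-congˡ {x = a} (-‿cong W≈V) ⟩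
    a - V                          ≈⟨ solve 3 (λ z t g →
                                        let a = con 1ℚ :+ z :* z :- z :* z :* t
                                        in a :- (a :- con (fromℕ 2) :* z :* (z :* g)) := con (fromℕ 2) :* z :* (z :* g))
                                      (λ _ _ → ≡.refl) z t G ⟩
    κ (fromℕ 2) * z * (z * G)      ≈⟨ *-comm _ _ ⟩
    z * G * (κ (fromℕ 2) * z)      ∎)

  F-times-den : F * den ≈ 1# - z * G
  F-times-den = trans
    (solve 4 (λ z t f g →
       f :* (con 1ℚ :- con (fromℕ 2) :* z :+ z :* z :- z :* z :* z :- z :* z :* t :+ z :* z :* z :* t)
       := (con 1ℚ :- z :* g)
          :+ (con 1ℚ :- z :* g) :* (f :- (con 1ℚ :+ z :* (f :+ z :* ((t :+ (g :- con 1ℚ)) :* f))))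
          :+ z :* f :* (g :- (con 1ℚ :+ z :* (z :* (con 1ℚ :* (con 1ℚ :+ t :* (g :- con 1ℚ)) :+ (g :- con 1ℚ) :* g)))))
       (λ _ _ → ≡.refl) z t F G)
    (trans (modulo _ _ G-equation) (modulo _ _ F-equation))

  dispersed-generating-function : (W r₂ : Ser2) →
    W S2.* W S2.≈ radicand → W 0 0 ≡ 1ℚ →
    S2.const (fromℕ 2) S2.* S2.z S2.* r₂ S2.≈ aPoly S2.- W →
    Φ S2.* denomPoly S2.≈ one₂ S2.- r₂
  dispersed-generating-function W r₂ W²≈rad W00≡1 2zr₂≈a-W = begin
    Φ S2.* denomPoly   ≈⟨ Agree₂.* Φ-dispersedGF denomPoly-agrees ⟩
    F * den            ≈⟨ F-times-den ⟩
    1# - z * G         ≈⟨ +-congˡ {x = 1#} (-‿cong r₂≈zG) ⟨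
    1# - r₂            ≈⟨ Agree₂.- (Agree₂.const 1ℚ) refl ⟨
    one₂ S2.- r₂       ∎
    where
    W≈V : W ≈ V
    W≈V = W-is-V W (trans (sym (Agree₂.* refl refl)) (trans W²≈rad radicand-agrees)) W00≡1
    r₂≈zG : r₂ ≈ z * G
    r₂≈zG = r₂-is-zG W r₂ W≈V
      (trans (sym (Agree₂.* (Agree₂.* (Agree₂.const (fromℕ 2)) Agree₂.z) refl)) (trans 2zr₂≈a-W (Agree₂.- aPoly-agrees refl)))

module TotalOneDescents where

  open CommutativeRing Series₁.seriesRing
  open Series₁ using (Series; X; const)
  open CommutativeRingLemmas Series₁.seriesRing
  open Solver₁ using (solve; _:=_; con; _:+_; _:*_; _:-_)
  open import Relation.Binary.Reasoning.Setoid setoid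

  z : Series
  z = X

  F C P E : Series
  F = PathSeries₁.dispersedGF 1ℚ
  C = PathSeries₁.dyckGF 1ℚ
  P = PathSeries₁.dispersedTotal
  E = PathSeries₁.dyckTotal

  F-equation : F ≈ 1# + z * (F + z * ((1# + (C - 1#)) * F))
  F-equation = PathSeries₁.dispersedGF-equation 1ℚ

  C-equation : C ≈ 1# + z * (z * (1# * (1# + 1# * (C - 1#)) + (C - 1#) * C))
  C-equation = PathSeries₁.dyckGF-equation 1ℚ

  P-equation : P ≈ const 0ℚ + z * (P + z * (1# * (F + P) + (E * F + (C - 1#) * P)))
  P-equation = PathSeries₁.dispersedTotal-equation

  E-equation : E ≈ const 0ℚ + z * (z * (1# * ((C - 1#) + E) + (E * C + (C - 1#) * E)))
  E-equation = PathSeries₁.dyckTotal-equation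

  O4 den : Series
  O4  = 1# - const (fromℕ 4) * z * z
  den = const (fromℕ 2) * (1# - const (fromℕ 2) * z) * O4

  oneMinus4z²-agrees : oneMinus4z² ≈ O4
  oneMinus4z²-agrees = A.- (A.const 1ℚ) (A.* (A.* (A.const (fromℕ 4)) A.z) A.z)
    where module A = Agree₁

  denom₁-agrees : denom₁ ≈ den
  denom₁-agrees = A.* (A.* (A.const (fromℕ 2)) (A.- (A.const 1ℚ) (A.* (A.const (fromℕ 2)) A.z))) oneMinus4z²-agrees
    where module A = Agree₁

  root : Series
  root = 1# - const (fromℕ 2) * z * (z * C)

  root-squared : root * root ≈ O4
  root-squared = trans
    (solve 2 (λ z c →
       (con 1ℚ :- con (fromℕ 2) :* z :* (z :* c)) :* (con 1ℚ :- con (fromℕ 2) :* z :* (z :* c))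
       := (con 1ℚ :- con (fromℕ 4) :* z :* z)
          :+ con (ℚ.- fromℕ 4) :* (z :* z)
             :* (c :- (con 1ℚ :+ z :* (z :* (con 1ℚ :* (con 1ℚ :+ con 1ℚ :* (c :- con 1ℚ)) :+ (c :- con 1ℚ) :* c)))))
       (λ _ → ≡.refl) z C)
    (modulo O4 _ C-equation)

  -- The multipliers encode F (1 - z - z²C) = 1, hence P = z²(E + 1)F², together with
  -- 2(E + 1) root = 1 + root - 2z² and C = (1 - 2z)F².
  P-times-den : P * den ≈ z * z * (O4 + root)
  P-times-den = trans
    (solve 5 (λ z c f p e →
       let one = con 1ℚ
           two = con (fromℕ 2)
           O4 = one :- con (fromℕ 4) :* z :* z
           K = one :- z :- z :* z :* c
           T = one :- two :* z :* (z :* c)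
           mF = z :* z :* T :* (f :* K :+ one) :* (one :+ T) :- two :* (one :- two :* z) :* O4 :* p
           mP = two :* (one :- two :* z) :* O4 :* f
           mE = two :* z :* z :* (one :- two :* z) :* T :* f :* f
           mC = two :* (z :* z :* z :* z) :* (two :- two :* z :- z :* z :* c) :* T :* f :* f
                :+ con (fromℕ 8) :* (z :* z :* z :* z) :* (one :- two :* z) :* (e :+ one) :* f :* f
                :- con (fromℕ 4) :* (z :* z :* z :* z)
       in p :* (two :* (one :- two :* z) :* O4)
          := z :* z :* (O4 :+ T)
             :+ mF :* (f :- (one :+ z :* (f :+ z :* ((one :+ (c :- one)) :* f))))
             :+ mP :* (p :- (con 0ℚ :+ z :* (p :+ z :* (one :* (f :+ p) :+ (e :* f :+ (c :- one) :* p)))))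
             :+ mE :* (e :- (con 0ℚ :+ z :* (z :* (one :* ((c :- one) :+ e) :+ (e :* c :+ (c :- one) :* e)))))
             :+ mC :* (c :- (one :+ z :* (z :* (one :* (one :+ one :* (c :- one)) :+ (c :- one) :* c)))))
       (λ _ → ≡.refl) z C F P E)
    (trans (modulo _ _ C-equation) (trans (modulo _ _ E-equation) (trans (modulo _ _ P-equation) (modulo _ _ F-equation))))

  total-generating-function : (S : Ser1) →
    S S1.* S S1.≈ oneMinus4z² → S 0 ≡ 1ℚ →
    Ψ S1.* denom₁ S1.≈ S1.z S1.* S1.z S1.* (oneMinus4z² S1.+ S)
  total-generating-function S S²≈O4 S0≡1 = begin
    Ψ S1.* denom₁              ≈⟨ Agree₁.* Ψ-dispersedTotal denom₁-agrees ⟩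
    P * den                    ≈⟨ P-times-den ⟩
    z * z * (O4 + root)        ≈⟨ *-congˡ {x = z * z} (+-congˡ {x = O4} S≈root) ⟨
    z * z * (O4 + S)           ≈⟨ Agree₁.* (Agree₁.* Agree₁.z Agree₁.z) (Agree₁.+ oneMinus4z²-agrees refl) ⟨
    S1.z S1.* S1.z S1.* (oneMinus4z² S1.+ S) ∎
    where
    S≈root : S ≈ root
    S≈root = square-root-unique (constant-two-regular₁ (S + root) (≡.cong (ℚ._+ 1ℚ) S0≡1))
      (trans (trans (sym (Agree₁.* refl refl)) (trans S²≈O4 oneMinus4z²-agrees)) (sym root-squared))

mainTheorem4 :
    ((W r₂ : Ser2) →
      W S2.* W S2.≈ radicand → W 0 0 ≡ 1ℚ →
      S2.const (fromℕ 2) S2.* S2.z S2.* r₂ S2.≈ aPoly S2.- W →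
      Φ S2.* denomPoly S2.≈ one₂ S2.- r₂)
    ×
    ((S : Ser1) →
      S S1.* S S1.≈ oneMinus4z² → S 0 ≡ 1ℚ →
      Ψ S1.* denom₁ S1.≈ S1.z S1.* S1.z S1.* (oneMinus4z² S1.+ S))
mainTheorem4 = DispersedPaths.dispersed-generating-function , TotalOneDescents.total-generating-function
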